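{- Fix a prime $p$. Let $a \ge 0$ and $d > 0$ be integers, and let $q$ be a positive integer coprime to $p$. Then the vectors $$\psi_d(a),\ \psi_d(a+q),\ \ldots,\ \psi_d(a+(d-1)q) \in F_p^{d}$$ form a basis of $F_p^{d}$.
   Context: For a nonnegative integer $i$, $\psi_d(i) = \left(\binom{i}{0}, \binom{i}{1}, \ldots, \binom{i}{d-1}\right)$, with entries reduced modulo $p$, viewed as a vector in $F_p^d$. -}

module Defs where

open import Data.Nat using (ℕ; zero; suc; _+_; _*_; _%_; NonZero)
open import Data.Nat.Combinatorics using (_C_)
open import Data.Nat.Primality using (Prime; prime⇒nonZero)
open import Data.Fin using (Fin; toℕ)
open import Data.Product using (∃)
open import Relation.Binary.PropositionalEquality using (_≡_)

Σ : (n : ℕ) → (Fin n → ℕ) → ℕ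
Σ zero    f = 0
Σ (suc n) f = f Fin.zero + Σ n (λ j → f (Fin.suc j))

-- Everything below is relative to a fixed prime p; elements of F_p are
-- represented by natural numbers, two of them being equal in F_p iff they
-- are congruent mod p. Vectors in F_p^d are functions Fin d → ℕ.
module _ (p : ℕ) (pp : Prime p) where
  private instance
    p≢0 : NonZero p
    p≢0 = prime⇒nonZero pp

  _≈ₚ_ : ℕ → ℕ → Set
  x ≈ₚ y = x % p ≡ y % p

  ψ : (d : ℕ) → ℕ → Fin d → ℕ
  ψ d i k = (i C toℕ k) % p

  linComb : {m d : ℕ} → (Fin m → ℕ) → (Fin m → Fin d → ℕ) → Fin d → ℕ
  linComb {m} c v k = Σ m (λ j → c j * v j k)

  LinearlyIndependent : {m d : ℕ} → (Fin m → Fin d → ℕ) → Set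
  LinearlyIndependent {m} {d} v =
    (c : Fin m → ℕ) → (∀ k → linComb c v k ≈ₚ 0) → ∀ j → c j ≈ₚ 0

  Spans : {m d : ℕ} → (Fin m → Fin d → ℕ) → Set
  Spans {m} {d} v =
    (w : Fin d → ℕ) → ∃ λ (c : Fin m → ℕ) → ∀ k → linComb c v k ≈ₚ w k

  record IsBasis {m d : ℕ} (v : Fin m → Fin d → ℕ) : Set where
    field
      independent : LinearlyIndependent v
      spans       : Spans v

module Submission where

-- Let M be the d × d matrix M_jk = (a + j q) C k.  By Vandermonde's identity, raising the
-- top of a binomial row from x to x + q adds E(row x), where (E w)_k = Σ_{i<k} (q C (k−i)) w_i.
-- Hence row(a + j q) = (1 + E)^j row(a) = Σ_m (j C m) E^m row(a), i.e. M = L T with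
-- L_jm = j C m lower unitriangular and T_mk = (E^m row(a))_k.  Since E shifts the first nonzero
-- entry of a row one place to the right and multiplies it by q, T is upper triangular with
-- diagonal q^m, a unit mod p.  Both factors, hence M, are invertible over F_p.

open import Defs
open import Data.Nat using (ℕ; zero; suc; _<_; _≤_; z≤n; s≤s; NonZero)
open import Data.Nat.Primality using (Prime; prime⇒nonZero)
open import Data.Nat.Coprimality using (Coprime; coprime-Bézout)
open import Data.Nat.GCD using (module Bézout)
open import Data.Nat.Combinatorics using (_C_; nC1≡n; nCn≡1; nCk+nC[k+1]≡[n+1]C[k+1]; k>n⇒nCk≡0)
open import Data.Nat.DivMod using (%-distribˡ-+; %-distribˡ-*; m*n%n≡0; m%n%n≡m%n)
open import Data.Nat.Tactic.RingSolver using (solve-∀)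
open import Data.Fin using (Fin; toℕ; zero; suc)
open import Data.Fin.Properties using (toℕ<n)
open import Data.Product using (∃; _,_; proj₁; proj₂)
open import Function using (_∘_)
open import Level using (0ℓ; _⊔_)
open import Algebra.Bundles using (Ring; CommutativeRing)

module RowSpace {c ℓ} (R : Ring c ℓ) where
  open Ring R hiding (zero)
  open import Algebra.Definitions _≈_ using (Invertible)
  open import Algebra.Properties.Semiring.Sum semiring
    using (sum; sum-syntax; sum-cong-≋; sum-replicate-zero; ∑-comm; *-distribˡ-sum; *-distribʳ-sum)
  open import Algebra.Properties.AbelianGroup +-abelianGroup using (xyx⁻¹≈y)
  open import Algebra.Properties.Monoid *-monoid using (cancelʳ; cancelᶜ; insertʳ)
  open import Relation.Binary.Reasoning.Setoid setoid

  Matrix : ℕ → ℕ → Set c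
  Matrix m d = Fin m → Fin d → Carrier

  linearCombination : ∀ {m d} → (Fin m → Carrier) → Matrix m d → Fin d → Carrier
  linearCombination {m} x v k = ∑[ j < m ] (x j * v j k)

  _·_ : ∀ {m n d} → Matrix m n → Matrix n d → Matrix m d
  (L · T) j = linearCombination (L j) T

  Independent : ∀ {m d} → Matrix m d → Set (c ⊔ ℓ)
  Independent {m} v = (x : Fin m → Carrier) → (∀ k → linearCombination x v k ≈ 0#) → ∀ j → x j ≈ 0#

  Spanning : ∀ {m d} → Matrix m d → Set (c ⊔ ℓ)
  Spanning {m} {d} v = (w : Fin d → Carrier) → ∃ λ (x : Fin m → Carrier) → ∀ k → linearCombination x v k ≈ w k

  record Basis {m d} (v : Matrix m d) : Set (c ⊔ ℓ) where
    field
      independent : Independent v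
      spans       : Spanning v

  open Basis

  sum-≈0 : ∀ {n} {f : Fin n → Carrier} → (∀ i → f i ≈ 0#) → sum f ≈ 0#
  sum-≈0 {n} f≈0 = trans (sum-cong-≋ f≈0) (sum-replicate-zero n)

  linearCombination-· : ∀ {m n d} x (L : Matrix m n) (T : Matrix n d) k →
    linearCombination x (L · T) k ≈ linearCombination (linearCombination x L) T k
  linearCombination-· {m} {n} x L T k = begin
    ∑[ j < m ] (x j * ∑[ i < n ] (L j i * T i k))
      ≈⟨ sum-cong-≋ (λ j → *-distribˡ-sum (x j) (λ i → L j i * T i k)) ⟩
    ∑[ j < m ] ∑[ i < n ] (x j * (L j i * T i k))
      ≈⟨ sum-cong-≋ (λ j → sum-cong-≋ (λ i → sym (*-assoc (x j) (L j i) (T i k)))) ⟩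
    ∑[ j < m ] ∑[ i < n ] (x j * L j i * T i k)
      ≈⟨ ∑-comm (λ j i → x j * L j i * T i k) ⟩
    ∑[ i < n ] ∑[ j < m ] (x j * L j i * T i k)
      ≈⟨ sum-cong-≋ (λ i → sym (*-distribʳ-sum (T i k) (λ j → x j * L j i))) ⟩
    ∑[ i < n ] (∑[ j < m ] (x j * L j i) * T i k)
      ∎

  basis-· : ∀ {m n d} {L : Matrix m n} {T : Matrix n d} → Basis L → Basis T → Basis (L · T)
  basis-· {L = L} {T} bL bT = record { independent = indep ; spans = span }
    where
    indep : Independent (L · T)
    indep x x[LT]≈0 = independent bL x (independent bT _ λ k →
      trans (sym (linearCombination-· x L T k)) (x[LT]≈0 k))
    span : Spanning (L · T)
    span w with spans bT w
    ... | y , yT≈w with spans bL y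
    ...   | x , xL≈y = x , λ k → begin
      linearCombination x (L · T) k                   ≈⟨ linearCombination-· x L T k ⟩
      linearCombination (linearCombination x L) T k   ≈⟨ sum-cong-≋ (λ i → *-congʳ (xL≈y i)) ⟩
      linearCombination y T k                         ≈⟨ yT≈w k ⟩
      w k                                             ∎

  Unit : Carrier → Set (c ⊔ ℓ)
  Unit = Invertible 1# _*_

  unit-cancelʳ : ∀ {x u} → Unit u → x * u ≈ 0# → x ≈ 0#
  unit-cancelʳ {x} (u⁻¹ , _ , uu⁻¹≈1) xu≈0 = trans (insertʳ uu⁻¹≈1 x) (trans (*-congʳ xu≈0) (zeroˡ u⁻¹))

  unit-divideʳ : ∀ {u} (inv : Unit u) w → w * proj₁ inv * u ≈ w
  unit-divideʳ (_ , u⁻¹u≈1 , _) = cancelʳ u⁻¹u≈1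

  1-unit : Unit 1#
  1-unit = 1# , *-identityˡ 1# , *-identityʳ 1#

  unit-* : ∀ {x y} → Unit x → Unit y → Unit (x * y)
  unit-* (x⁻¹ , x⁻¹x≈1 , xx⁻¹≈1) (y⁻¹ , y⁻¹y≈1 , yy⁻¹≈1) =
    y⁻¹ * x⁻¹ , trans (cancelᶜ x⁻¹x≈1 y⁻¹ _) y⁻¹y≈1 , trans (cancelᶜ yy⁻¹≈1 _ x⁻¹) xx⁻¹≈1

  basis-cong : ∀ {m d} {u v : Matrix m d} → (∀ j k → u j k ≈ v j k) → Basis v → Basis u
  basis-cong {u = u} {v} u≈v b = record
    { independent = λ x xu≈0 → independent b x (λ k → trans (sym (uv-combination x k)) (xu≈0 k))
    ; spans       = λ w → proj₁ (spans b w) , λ k → trans (uv-combination _ k) (proj₂ (spans b w) k)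
    }
    where
    uv-combination : ∀ x k → linearCombination x u k ≈ linearCombination x v k
    uv-combination x k = sum-cong-≋ (λ j → *-congˡ (u≈v j k))

  minor : ∀ {m d} → Matrix (suc m) (suc d) → Matrix m d
  minor v j k = v (suc j) (suc k)

  basis-empty : (v : Matrix 0 0) → Basis v
  basis-empty v = record { independent = λ _ _ () ; spans = λ _ → (λ ()) , λ () }

  basis-extend-zeroColumn : ∀ {n} {v : Matrix (suc n) (suc n)} → Unit (v zero zero) →
    (∀ j → v (suc j) zero ≈ 0#) → Basis (minor v) → Basis v
  basis-extend-zeroColumn {n} {v} v₀₀-unit column≈0 b = record { independent = indep ; spans = span }
    where
    rest≈0 : ∀ (x : Fin (suc n) → Carrier) → ∑[ j < n ] (x (suc j) * v (suc j) zero) ≈ 0#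
    rest≈0 x = sum-≈0 (λ j → trans (*-congˡ (column≈0 j)) (zeroʳ _))
    indep : Independent v
    indep x xv≈0 = λ { zero → x₀≈0 ; (suc j) → independent b (x ∘ suc) tail≈0 j }
      where
      x₀≈0 : x zero ≈ 0#
      x₀≈0 = unit-cancelʳ v₀₀-unit (begin
        x zero * v zero zero                                         ≈⟨ +-identityʳ _ ⟨
        x zero * v zero zero + 0#                                    ≈⟨ +-congˡ (rest≈0 x) ⟨
        linearCombination x v zero                                   ≈⟨ xv≈0 zero ⟩
        0#                                                           ∎)
      tail≈0 : ∀ k → linearCombination (x ∘ suc) (minor v) k ≈ 0#
      tail≈0 k = begin
        linearCombination (x ∘ suc) (minor v) k                      ≈⟨ +-identityˡ _ ⟨
        0# + linearCombination (x ∘ suc) (minor v) k                 ≈⟨ +-congʳ (trans (*-congʳ x₀≈0) (zeroˡ _)) ⟨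
        linearCombination x v (suc k)                                ≈⟨ xv≈0 (suc k) ⟩
        0#                                                           ∎
    span : Spanning v
    span w = x , λ { zero → first ; (suc k) → later k }
      where
      x₀ = w zero * proj₁ v₀₀-unit
      w′ : Fin n → Carrier
      w′ k = w (suc k) - x₀ * v zero (suc k)
      y = proj₁ (spans b w′)
      yv≈w′ = proj₂ (spans b w′)
      x : Fin (suc n) → Carrier
      x zero = x₀
      x (suc j) = y j
      first : linearCombination x v zero ≈ w zero
      first = begin
        x₀ * v zero zero + ∑[ j < n ] (y j * v (suc j) zero)         ≈⟨ +-congˡ (rest≈0 x) ⟩
        x₀ * v zero zero + 0#                                        ≈⟨ +-identityʳ _ ⟩
        x₀ * v zero zero                                             ≈⟨ unit-divideʳ v₀₀-unit (w zero) ⟩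
        w zero                                                       ∎
      later : ∀ k → linearCombination x v (suc k) ≈ w (suc k)
      later k = begin
        x₀ * v zero (suc k) + linearCombination y (minor v) k        ≈⟨ +-congˡ (yv≈w′ k) ⟩
        x₀ * v zero (suc k) + (w (suc k) - x₀ * v zero (suc k))      ≈⟨ +-assoc _ _ _ ⟨
        x₀ * v zero (suc k) + w (suc k) - x₀ * v zero (suc k)        ≈⟨ xyx⁻¹≈y _ _ ⟩
        w (suc k)                                                    ∎

  basis-extend-zeroRow : ∀ {n} {v : Matrix (suc n) (suc n)} → Unit (v zero zero) →
    (∀ k → v zero (suc k) ≈ 0#) → Basis (minor v) → Basis v
  basis-extend-zeroRow {n} {v} v₀₀-unit row≡0 b = record { independent = indep ; spans = span }
    where
    head≈0 : ∀ x k → x * v zero (suc k) ≈ 0#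
    head≈0 x k = trans (*-congˡ (row≡0 k)) (zeroʳ x)
    indep : Independent v
    indep x xv≈0 = λ { zero → x₀≈0 ; (suc j) → tail≈0 j }
      where
      tail≈0 : ∀ j → x (suc j) ≈ 0#
      tail≈0 = independent b (x ∘ suc) λ k → begin
        linearCombination (x ∘ suc) (minor v) k                      ≈⟨ +-identityˡ _ ⟨
        0# + linearCombination (x ∘ suc) (minor v) k                 ≈⟨ +-congʳ (head≈0 (x zero) k) ⟨
        linearCombination x v (suc k)                                ≈⟨ xv≈0 (suc k) ⟩
        0#                                                           ∎
      x₀≈0 : x zero ≈ 0#
      x₀≈0 = unit-cancelʳ v₀₀-unit (begin
        x zero * v zero zero                                         ≈⟨ +-identityʳ _ ⟨
        x zero * v zero zero + 0#                                    ≈⟨ +-congˡ (sum-≈0 λ j → trans (*-congʳ (tail≈0 j)) (zeroˡ _)) ⟨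
        linearCombination x v zero                                   ≈⟨ xv≈0 zero ⟩
        0#                                                           ∎)
    span : Spanning v
    span w = x , λ { zero → first ; (suc k) → later k }
      where
      y = proj₁ (spans b (w ∘ suc))
      yv≈w = proj₂ (spans b (w ∘ suc))
      s = linearCombination y (v ∘ suc) zero
      x₀ = (w zero - s) * proj₁ v₀₀-unit
      x : Fin (suc n) → Carrier
      x zero = x₀
      x (suc j) = y j
      first : linearCombination x v zero ≈ w zero
      first = begin
        x₀ * v zero zero + s                                         ≈⟨ +-congʳ (unit-divideʳ v₀₀-unit (w zero - s)) ⟩
        w zero - s + s                                               ≈⟨ +-assoc _ _ _ ⟩
        w zero + (- s + s)                                           ≈⟨ +-congˡ (-‿inverseˡ s) ⟩
        w zero + 0#                                                  ≈⟨ +-identityʳ _ ⟩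
        w zero                                                       ∎
      later : ∀ k → linearCombination x v (suc k) ≈ w (suc k)
      later k = begin
        x₀ * v zero (suc k) + linearCombination y (minor v) k        ≈⟨ +-cong (head≈0 x₀ k) (yv≈w k) ⟩
        0# + w (suc k)                                               ≈⟨ +-identityˡ _ ⟩
        w (suc k)                                                    ∎

  UpperTriangular : ∀ {n} → Matrix n n → Set ℓ
  UpperTriangular v = ∀ j k → toℕ k < toℕ j → v j k ≈ 0#

  LowerTriangular : ∀ {n} → Matrix n n → Set ℓ
  LowerTriangular v = ∀ j k → toℕ j < toℕ k → v j k ≈ 0#

  InvertibleDiagonal : ∀ {n} → Matrix n n → Set (c ⊔ ℓ)
  InvertibleDiagonal v = ∀ j → Unit (v j j)

  upperTriangular⇒basis : ∀ {n} {v : Matrix n n} → UpperTriangular v → InvertibleDiagonal v → Basis v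
  upperTriangular⇒basis {zero}  {v} _ _ = basis-empty v
  upperTriangular⇒basis {suc n} upper diag = basis-extend-zeroColumn (diag zero) (λ j → upper (suc j) zero (s≤s z≤n))
    (upperTriangular⇒basis (λ j k k<j → upper (suc j) (suc k) (s≤s k<j)) (diag ∘ suc))

  lowerTriangular⇒basis : ∀ {n} {v : Matrix n n} → LowerTriangular v → InvertibleDiagonal v → Basis v
  lowerTriangular⇒basis {zero}  {v} _ _ = basis-empty v
  lowerTriangular⇒basis {suc n} lower diag = basis-extend-zeroRow (diag zero) (λ k → lower zero (suc k) (s≤s z≤n))
    (lowerTriangular⇒basis (λ j k j<k → lower (suc j) (suc k) (s≤s j<k)) (diag ∘ suc))

module Residues (n : ℕ) .{{_ : NonZero n}} where
  open import Data.Nat using (_+_; _*_; _%_; pred)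
  open import Data.Nat.Properties
  open import Relation.Binary.PropositionalEquality

  infix 4 _≡[mod]_
  _≡[mod]_ : ℕ → ℕ → Set
  x ≡[mod] y = x % n ≡ y % n

  ≡⇒≡[mod] : ∀ {x y} → x ≡ y → x ≡[mod] y
  ≡⇒≡[mod] = cong (_% n)

  -[mod]_ : ℕ → ℕ
  -[mod] x = pred n * x

  private
    +-cong-mod : ∀ {x y u v} → x ≡[mod] y → u ≡[mod] v → x + u ≡[mod] y + v
    +-cong-mod {x} {y} {u} {v} x≡y u≡v =
      trans (%-distribˡ-+ x u n) (trans (cong₂ (λ a b → (a + b) % n) x≡y u≡v) (sym (%-distribˡ-+ y v n)))

    *-cong-mod : ∀ {x y u v} → x ≡[mod] y → u ≡[mod] v → x * u ≡[mod] y * v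
    *-cong-mod {x} {y} {u} {v} x≡y u≡v =
      trans (%-distribˡ-* x u n) (trans (cong₂ (λ a b → (a * b) % n) x≡y u≡v) (sym (%-distribˡ-* y v n)))

    multiple≡[mod]0 : ∀ k → k * n ≡[mod] 0
    multiple≡[mod]0 k = trans (m*n%n≡0 k n) (sym (m*n%n≡0 0 n))

    -‿inverseˡ-mod : ∀ x → -[mod] x + x ≡[mod] 0
    -‿inverseˡ-mod x = trans (≡⇒≡[mod] (begin
      pred n * x + x    ≡⟨ +-comm (pred n * x) x ⟩
      suc (pred n) * x  ≡⟨ cong (_* x) (suc-pred n) ⟩
      n * x             ≡⟨ *-comm n x ⟩
      x * n             ∎)) (multiple≡[mod]0 x)
      where open ≡-Reasoning

  residueRing : CommutativeRing 0ℓ 0ℓ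
  residueRing = record
    { Carrier = ℕ ; _≈_ = _≡[mod]_ ; _+_ = _+_ ; _*_ = _*_ ; -_ = -[mod]_ ; 0# = 0 ; 1# = 1
    ; isCommutativeRing = record
      { isRing = record
        { +-isAbelianGroup = record
          { isGroup = record
            { isMonoid = record
              { isSemigroup = record
                { isMagma = record
                  { isEquivalence = record { refl = refl ; sym = sym ; trans = trans }
                  ; ∙-cong = +-cong-mod }
                ; assoc = λ x y z → ≡⇒≡[mod] (+-assoc x y z) }
              ; identity = (λ x → ≡⇒≡[mod] (+-identityˡ x)) , (λ x → ≡⇒≡[mod] (+-identityʳ x)) }
            ; inverse = -‿inverseˡ-mod , (λ x → trans (≡⇒≡[mod] (+-comm x (-[mod] x))) (-‿inverseˡ-mod x))
            ; ⁻¹-cong = *-cong-mod {pred n} refl }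
          ; comm = λ x y → ≡⇒≡[mod] (+-comm x y) }
        ; *-cong = *-cong-mod
        ; *-assoc = λ x y z → ≡⇒≡[mod] (*-assoc x y z)
        ; *-identity = (λ x → ≡⇒≡[mod] (*-identityˡ x)) , (λ x → ≡⇒≡[mod] (*-identityʳ x))
        ; distrib = (λ x y z → ≡⇒≡[mod] (*-distribˡ-+ x y z)) , (λ x y z → ≡⇒≡[mod] (*-distribʳ-+ x y z)) }
      ; *-comm = λ x y → ≡⇒≡[mod] (*-comm x y) } }

  open RowSpace (CommutativeRing.ring residueRing) using (Unit)

  coprime⇒unit : ∀ {q} → Coprime q n → Unit q
  coprime⇒unit {q} q⊥n = invertibleˡ⇒invertible (leftInverse (coprime-Bézout q⊥n))
    where
    open CommutativeRing residueRing using (*-commutativeMonoid; +-group; ring)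
    open import Algebra.Properties.CommutativeMonoid *-commutativeMonoid using (invertibleˡ⇒invertible)
    open import Algebra.Properties.Group +-group using (inverseˡ-unique)
    open import Algebra.Properties.Ring ring using (-‿distribˡ-*)
    open import Relation.Binary.Reasoning.Setoid (CommutativeRing.setoid residueRing)
    leftInverse : Bézout.Identity 1 q n → ∃ λ y → y * q ≡[mod] 1
    leftInverse (Bézout.+- x y 1+yn≡xq) = x , (begin
      x * q      ≡⟨ 1+yn≡xq ⟨
      1 + y * n  ≈⟨ +-cong-mod {1} refl (multiple≡[mod]0 y) ⟩
      1 + 0      ∎)
    leftInverse (Bézout.-+ x y 1+xq≡yn) = -[mod] x , (begin
      -[mod] x * q     ≈⟨ -‿distribˡ-* x q ⟨
      -[mod] (x * q)   ≈⟨ inverseˡ-unique 1 (x * q) (trans (≡⇒≡[mod] 1+xq≡yn) (multiple≡[mod]0 y)) ⟨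
      1                ∎)

module BinomialRows where
  open import Data.Nat using (_+_; _*_; _^_)
  open import Data.Nat.Properties
  open import Relation.Binary.PropositionalEquality
  open ≡-Reasoning
  open import Algebra.Properties.Semiring.Sum +-*-semiring
    using (sum-syntax; sum-cong-≗; sum-replicate-zero; ∑-distrib-+; *-distribˡ-sum)

  ∑-last-zero : ∀ N (f : ℕ → ℕ) → f N ≡ 0 → ∑[ m < suc N ] f (toℕ m) ≡ ∑[ m < N ] f (toℕ m)
  ∑-last-zero zero    f f0≡0 = trans (+-identityʳ (f 0)) f0≡0
  ∑-last-zero (suc N) f fN≡0 = cong (f 0 +_) (∑-last-zero N (f ∘ suc) fN≡0)

  module _ (q : ℕ) where

    -- The operator E: shiftIncrement w k = Σ_{i<k} (q C (k − i)) * w i.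
    shiftIncrement : (ℕ → ℕ) → ℕ → ℕ
    shiftIncrement w zero    = 0
    shiftIncrement w (suc k) = (q C suc k) * w 0 + shiftIncrement (w ∘ suc) k

    shiftIncrement-cong : ∀ {u v} → (∀ i → u i ≡ v i) → ∀ k → shiftIncrement u k ≡ shiftIncrement v k
    shiftIncrement-cong u≗v zero    = refl
    shiftIncrement-cong u≗v (suc k) =
      cong₂ (λ x y → (q C suc k) * x + y) (u≗v 0) (shiftIncrement-cong (u≗v ∘ suc) k)

    shiftIncrement-+ : ∀ u v k → shiftIncrement (λ i → u i + v i) k ≡ shiftIncrement u k + shiftIncrement v k
    shiftIncrement-+ u v zero    = refl
    shiftIncrement-+ u v (suc k) = begin
      c * (u 0 + v 0) + shiftIncrement (λ i → u (suc i) + v (suc i)) k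
        ≡⟨ cong (c * (u 0 + v 0) +_) (shiftIncrement-+ (u ∘ suc) (v ∘ suc) k) ⟩
      c * (u 0 + v 0) + (shiftIncrement (u ∘ suc) k + shiftIncrement (v ∘ suc) k)
        ≡⟨ rearrange c (u 0) (v 0) _ _ ⟩
      (c * u 0 + shiftIncrement (u ∘ suc) k) + (c * v 0 + shiftIncrement (v ∘ suc) k) ∎
      where
      c = q C suc k
      rearrange : ∀ c x y s t → c * (x + y) + (s + t) ≡ (c * x + s) + (c * y + t)
      rearrange = solve-∀

    shiftIncrement-linear : ∀ {N} (c : Fin N → ℕ) (u : Fin N → ℕ → ℕ) k →
      shiftIncrement (λ i → ∑[ m < N ] (c m * u m i)) k ≡ ∑[ m < N ] (c m * shiftIncrement (u m) k)
    shiftIncrement-linear {N} c u zero = sym (trans (sum-cong-≗ (λ m → *-zeroʳ (c m))) (sum-replicate-zero N))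
    shiftIncrement-linear {N} c u (suc k) = begin
      b * ∑[ m < N ] (c m * u m 0) + shiftIncrement (λ i → ∑[ m < N ] (c m * u m (suc i))) k
        ≡⟨ cong₂ _+_ (*-distribˡ-sum b (λ m → c m * u m 0)) (shiftIncrement-linear c (λ m → u m ∘ suc) k) ⟩
      ∑[ m < N ] (b * (c m * u m 0)) + ∑[ m < N ] (c m * shiftIncrement (u m ∘ suc) k)
        ≡⟨ ∑-distrib-+ (λ m → b * (c m * u m 0)) (λ m → c m * shiftIncrement (u m ∘ suc) k) ⟨
      ∑[ m < N ] (b * (c m * u m 0) + c m * shiftIncrement (u m ∘ suc) k)
        ≡⟨ sum-cong-≗ (λ m → factor b (c m) (u m 0) _) ⟩
      ∑[ m < N ] (c m * shiftIncrement (u m) (suc k)) ∎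
      where
      b = q C suc k
      factor : ∀ b c x s → b * (c * x) + c * s ≡ c * (b * x + s)
      factor = solve-∀

    shiftIncrement-zero : ∀ k → shiftIncrement (λ _ → 0) k ≡ 0
    shiftIncrement-zero zero    = refl
    shiftIncrement-zero (suc k) = cong₂ _+_ (*-zeroʳ (q C suc k)) (shiftIncrement-zero k)

    vandermonde : ∀ x k → (x + q) C k ≡ x C k + shiftIncrement (x C_) k
    vandermonde zero    zero    = refl
    vandermonde zero    (suc k) = begin
      q C suc k                                       ≡⟨ *-identityʳ (q C suc k) ⟨
      (q C suc k) * 1                                 ≡⟨ +-identityʳ _ ⟨
      (q C suc k) * 1 + 0                             ≡⟨ cong ((q C suc k) * 1 +_) (shiftIncrement-zero k) ⟨
      (q C suc k) * 1 + shiftIncrement (λ i → 0 C suc i) k ∎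
    vandermonde (suc x) zero    = refl
    vandermonde (suc x) (suc k) = begin
      suc (x + q) C suc k
        ≡⟨ pascal (x + q) k ⟨
      (x + q) C k + (x + q) C suc k
        ≡⟨ cong₂ _+_ (vandermonde x k) (vandermonde x (suc k)) ⟩
      (x C k + I k) + (x C suc k + ((q C suc k) * 1 + I′ k))
        ≡⟨ rearrange (x C k) (x C suc k) (I k) (I′ k) ((q C suc k) * 1) ⟩
      (x C k + x C suc k) + ((q C suc k) * 1 + (I k + I′ k))
        ≡⟨ cong₂ (λ y z → y + ((q C suc k) * 1 + z)) (pascal x k) (sym (shiftIncrement-+ (x C_) (λ i → x C suc i) k)) ⟩
      suc x C suc k + ((q C suc k) * 1 + shiftIncrement (λ i → x C i + x C suc i) k)
        ≡⟨ cong (λ z → suc x C suc k + ((q C suc k) * 1 + z)) (shiftIncrement-cong (pascal x) k) ⟩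
      suc x C suc k + shiftIncrement (suc x C_) (suc k) ∎
      where
      I  = shiftIncrement (x C_)
      I′ = shiftIncrement (λ i → x C suc i)
      pascal = nCk+nC[k+1]≡[n+1]C[k+1]
      rearrange : ∀ a b s t u → (a + s) + (b + (u + t)) ≡ (a + b) + (u + (s + t))
      rearrange = solve-∀

    shiftIncrement-vanishes : ∀ {w} m → (∀ i → i < m → w i ≡ 0) → ∀ k → k ≤ m → shiftIncrement w k ≡ 0
    shiftIncrement-vanishes m       w≡0 zero    _         = refl
    shiftIncrement-vanishes {w} (suc m) w≡0 (suc k) (s≤s k≤m) = begin
      (q C suc k) * w 0 + shiftIncrement (w ∘ suc) k
        ≡⟨ cong₂ (λ x y → (q C suc k) * x + y) (w≡0 0 (s≤s z≤n)) (shiftIncrement-vanishes m w∘suc≡0 k k≤m) ⟩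
      (q C suc k) * 0 + 0
        ≡⟨ cong (_+ 0) (*-zeroʳ (q C suc k)) ⟩
      0 ∎
      where
      w∘suc≡0 : ∀ i → i < m → w (suc i) ≡ 0
      w∘suc≡0 i i<m = w≡0 (suc i) (s≤s i<m)

    shiftIncrement-diagonal : ∀ {w} m → (∀ i → i < m → w i ≡ 0) → shiftIncrement w (suc m) ≡ q * w m
    shiftIncrement-diagonal {w} zero    _   = trans (+-identityʳ _) (cong (_* w 0) (nC1≡n q))
    shiftIncrement-diagonal {w} (suc m) w≡0 = begin
      (q C suc (suc m)) * w 0 + shiftIncrement (w ∘ suc) (suc m)
        ≡⟨ cong₂ (λ x y → (q C suc (suc m)) * x + y) (w≡0 0 (s≤s z≤n)) (shiftIncrement-diagonal m w∘suc≡0) ⟩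
      (q C suc (suc m)) * 0 + q * w (suc m)
        ≡⟨ cong (_+ q * w (suc m)) (*-zeroʳ (q C suc (suc m))) ⟩
      q * w (suc m) ∎
      where
      w∘suc≡0 : ∀ i → i < m → w (suc i) ≡ 0
      w∘suc≡0 i i<m = w≡0 (suc i) (s≤s i<m)

    -- Δ a m k is the m-th forward difference of j ↦ (a + j q) C k at j = 0.
    Δ : ℕ → ℕ → ℕ → ℕ
    Δ a zero    = a C_
    Δ a (suc m) = shiftIncrement (Δ a m)

    Δ-vanishes : ∀ a m k → k < m → Δ a m k ≡ 0
    Δ-vanishes a (suc m) k k<1+m = shiftIncrement-vanishes m (Δ-vanishes a m) k (≤-pred k<1+m)

    Δ-diagonal : ∀ a m → Δ a m m ≡ q ^ m
    Δ-diagonal a zero    = refl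
    Δ-diagonal a (suc m) = trans (shiftIncrement-diagonal m (Δ-vanishes a m)) (cong (q *_) (Δ-diagonal a m))

    newtonSum : ℕ → ℕ → ℕ → ℕ → ℕ
    newtonSum N a j k = ∑[ m < N ] ((j C toℕ m) * Δ a (toℕ m) k)

    newtonSum-suc : ∀ {N} a j k → j < N →
      newtonSum (suc N) a j k + shiftIncrement (newtonSum (suc N) a j) k ≡ newtonSum (suc N) a (suc j) k
    newtonSum-suc {N} a j k j<N = begin
      (1 * (a C k) + A) + shiftIncrement (newtonSum (suc N) a j) k
        ≡⟨ cong (1 * (a C k) + A +_) (shiftIncrement-linear {suc N} (λ m → j C toℕ m) (λ m → Δ a (toℕ m)) k) ⟩
      (1 * (a C k) + A) + ∑[ m < suc N ] ((j C toℕ m) * D (toℕ m))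
        ≡⟨ cong (1 * (a C k) + A +_) (∑-last-zero N (λ m → (j C m) * D m) (cong (_* D N) (k>n⇒nCk≡0 j<N))) ⟩
      (1 * (a C k) + A) + B
        ≡⟨ +-assoc-comm (1 * (a C k)) A B ⟩
      1 * (a C k) + (B + A)
        ≡⟨ cong (1 * (a C k) +_) (∑-distrib-+ {N} (λ m → (j C toℕ m) * D (toℕ m)) (λ m → (j C suc (toℕ m)) * D (toℕ m))) ⟨
      1 * (a C k) + ∑[ m < N ] ((j C toℕ m) * D (toℕ m) + (j C suc (toℕ m)) * D (toℕ m))
        ≡⟨ cong (1 * (a C k) +_) (sum-cong-≗ {N} λ m → trans (sym (*-distribʳ-+ (D (toℕ m)) (j C toℕ m) _))
             (cong (_* D (toℕ m)) (nCk+nC[k+1]≡[n+1]C[k+1] j (toℕ m)))) ⟩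
      newtonSum (suc N) a (suc j) k ∎
      where
      D : ℕ → ℕ
      D m = Δ a (suc m) k
      A = ∑[ m < N ] ((j C suc (toℕ m)) * D (toℕ m))
      B = ∑[ m < N ] ((j C toℕ m) * D (toℕ m))
      +-assoc-comm : ∀ a b c → a + b + c ≡ a + (c + b)
      +-assoc-comm = solve-∀

    newton : ∀ {N} a j k → j < N → (a + j * q) C k ≡ newtonSum N a j k
    newton {suc N} a zero    k _ = begin
      (a + 0) C k                              ≡⟨ cong (_C k) (+-identityʳ a) ⟩
      a C k                                    ≡⟨ +-identityʳ (a C k) ⟨
      a C k + 0                                ≡⟨ cong₂ _+_ (+-identityʳ (a C k)) (sum-replicate-zero N) ⟨
      1 * (a C k) + ∑[ m < N ] 0               ∎
    newton {suc N} a (suc j) k (s≤s j<N) = begin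
      (a + (q + j * q)) C k
        ≡⟨ cong (_C k) (+-comm-assoc a q (j * q)) ⟩
      (a + j * q + q) C k
        ≡⟨ vandermonde (a + j * q) k ⟩
      (a + j * q) C k + shiftIncrement ((a + j * q) C_) k
        ≡⟨ cong₂ _+_ (newton a j k j<1+N) (shiftIncrement-cong (λ i → newton a j i j<1+N) k) ⟩
      newtonSum (suc N) a j k + shiftIncrement (newtonSum (suc N) a j) k
        ≡⟨ newtonSum-suc a j k j<N ⟩
      newtonSum (suc N) a (suc j) k ∎
      where
      j<1+N = m<n⇒m<1+n j<N
      +-comm-assoc : ∀ a b c → a + (b + c) ≡ a + c + b
      +-comm-assoc = solve-∀

open import Data.Nat using (_+_; _*_; _^_; _>_)
open import Data.Nat.Properties using (+-*-semiring)
open import Relation.Binary.PropositionalEquality using (_≡_; refl; cong; subst; sym)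
open import Algebra.Properties.Semiring.Sum +-*-semiring using (sum-syntax)
open BinomialRows

module _ (n : ℕ) .{{_ : NonZero n}} where
  open Residues n
  open RowSpace (CommutativeRing.ring residueRing)

  unit-^ : ∀ {q} → Unit q → ∀ m → Unit (q ^ m)
  unit-^ q-unit zero    = 1-unit
  unit-^ q-unit (suc m) = unit-* q-unit (unit-^ q-unit m)

  binomialRows-basis : ∀ a d q → Unit q → Basis (λ (j k : Fin d) → (a + toℕ j * q) C toℕ k)
  binomialRows-basis a d q q-unit = basis-cong newton-factorisation (basis-· L-basis T-basis)
    where
    L T : Matrix d d
    L j m = toℕ j C toℕ m
    T m k = Δ q a (toℕ m) (toℕ k)
    newton-factorisation : ∀ j k → (a + toℕ j * q) C toℕ k ≡[mod] (L · T) j k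
    newton-factorisation j k = ≡⇒≡[mod] (newton q a (toℕ j) (toℕ k) (toℕ<n j))
    L-basis : Basis L
    L-basis = lowerTriangular⇒basis (λ j m j<m → ≡⇒≡[mod] (k>n⇒nCk≡0 j<m))
      (λ j → subst Unit (sym (nCn≡1 (toℕ j))) 1-unit)
    T-basis : Basis T
    T-basis = upperTriangular⇒basis (λ m k k<m → ≡⇒≡[mod] (Δ-vanishes q a (toℕ m) (toℕ k) k<m))
      (λ m → subst Unit (sym (Δ-diagonal q a (toℕ m))) (unit-^ q-unit (toℕ m)))

Σ≡∑ : ∀ n (f : Fin n → ℕ) → Σ n f ≡ ∑[ j < n ] f j
Σ≡∑ zero    f = refl
Σ≡∑ (suc n) f = cong (f zero +_) (Σ≡∑ n (f ∘ suc))

module _ (p : ℕ) (pp : Prime p) where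
  private instance
    p≢0 : NonZero p
    p≢0 = prime⇒nonZero pp

  open Residues p
  open RowSpace (CommutativeRing.ring residueRing)

  basis⇒IsBasis : ∀ {m d} {v : Matrix m d} → Basis v → IsBasis p pp v
  basis⇒IsBasis {m} {v = v} b = record
    { independent = λ x xv≈0 → Basis.independent b x λ k → subst (_≡[mod] 0) (Σ≡∑ m _) (xv≈0 k)
    ; spans       = λ w → proj₁ (Basis.spans b w) , λ k →
        subst (_≡[mod] w k) (sym (Σ≡∑ m _)) (proj₂ (Basis.spans b w) k)
    }

mainTheorem7 : (p : ℕ) (pp : Prime p) (a d q : ℕ) → d > 0 → q > 0 → Coprime q p →
    IsBasis p pp {d} {d} (λ (j : Fin d) → ψ p pp d (a + toℕ j * q))
mainTheorem7 p pp a d q _ _ q⊥p = basis⇒IsBasis p pp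
  (basis-cong (λ j k → m%n%n≡m%n ((a + toℕ j * q) C toℕ k) p)
    (binomialRows-basis p a d q (Residues.coprime⇒unit p q⊥p)))
  where
  instance _ = prime⇒nonZero pp
  open RowSpace (CommutativeRing.ring (Residues.residueRing p)) using (basis-cong)
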